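{- Let $\mathcal D$ be a commutative variety of (unordered) algebras, let $X,Y\in\mathcal D$ and let $L:X^*\to Y$ be a language. Define the relation $\equiv_L$ on $|X^*|$ by $u\equiv_L v$ iff $L(x\bullet u\bullet y)=L(x\bullet v\bullet y)$ for all $x,y\in|X^*|$. Then $\equiv_L$ is a congruence on the $\mathcal D$-monoid $X^*$ (an equivalence relation that is a sub-$\mathcal D$-monoid of $X^*\times X^*$), and the quotient map $X^*\to X^*/{\equiv_L}$ is the syntactic $\mathcal D$-monoid of $L$, i.e. $\mathrm{Syn}(L)=X^*/{\equiv_L}$.
   Context: A commutative variety $\mathcal D$ is a variety of $\Sigma$-algebras, $\Sigma$ finitary, such that for all $A,B$ the set $[A,B]$ of homomorphisms is a subalgebra of $B^{|A|}$. Its tensor product $A\otimes B$ represents bimorphisms (maps $|A|\times|B|\to|C|$ that are homomorphisms in each variable), and $I$ is the free algebra on one generator. A $\mathcal D$-monoid is an object $M$ with a monoid structure $(|M|,\bullet,1)$ whose multiplication is a bimorphism; morphisms are homomorphisms preserving $\bullet,1$. $X^*$ is the free $\mathcal D$-monoid on $X$ with multiplication $\bullet$; a language is a morphism $L:X^*\to Y$ in $\mathcal D$. A $\mathcal D$-monoid morphism $e:X^*\to M$ recognizes $L$ if $L=f\circ e$ for some morphism $f:M\to Y$ of $\mathcal D$. An $X$-generated $\mathcal D$-monoid is a surjective $\mathcal D$-monoid morphism $e:X^*\to M$; $e_1\le e_2$ iff $e_1=h\circ e_2$ for a $\mathcal D$-monoid morphism $h$. The syntactic $\mathcal D$-monoid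 $\mathrm{Syn}(L)$ is the (unique up to isomorphism) $X$-generated $\mathcal D$-monoid recognizing $L$ that is $\le$ every $X$-generated $\mathcal D$-monoid recognizing $L$. -}

module Defs where

open import Level using (0ℓ)
open import Data.Nat using (ℕ)
open import Data.Fin using (Fin)
open import Data.Product using (Σ; _×_; _,_; ∃)
open import Function using (id)
open import Relation.Binary using (Rel; IsEquivalence)

record Signature : Set₁ where
  field
    Op    : Set
    arity : Op → ℕ

module _ (S : Signature) where
  open Signature S

  data Term (V : Set) : Set where
    var : V → Term V
    op  : (o : Op) → (Fin (arity o) → Term V) → Term V

  evalRaw : {C V : Set} → ((o : Op) → (Fin (arity o) → C) → C) →
            (V → C) → Term V → C
  evalRaw f ρ (var x)   = ρ x
  evalRaw f ρ (op o ts) = f o (λ i → evalRaw f ρ (ts i))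

  -- Σ-algebras on setoids (so that quotients are available)
  record Algebra : Set₁ where
    field
      Carrier       : Set
      _≈_           : Rel Carrier 0ℓ
      isEquivalence : IsEquivalence _≈_
      ⟦_⟧           : (o : Op) → (Fin (arity o) → Carrier) → Carrier
      ⟦⟧-cong       : ∀ o {as bs : Fin (arity o) → Carrier} →
                      (∀ i → as i ≈ bs i) → ⟦ o ⟧ as ≈ ⟦ o ⟧ bs

  open Algebra

  eval : (A : Algebra) {V : Set} → (V → Carrier A) → Term V → Carrier A
  eval A = evalRaw (⟦_⟧ A)

  record IsHom (A B : Algebra) (h : Carrier A → Carrier B) : Set where
    field
      cong      : ∀ {a b} → _≈_ A a b → _≈_ B (h a) (h b)
      preserves : ∀ o (as : Fin (arity o) → Carrier A) →
                  _≈_ B (h (⟦_⟧ A o as)) (⟦_⟧ B o (λ i → h (as i)))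

  record Hom (A B : Algebra) : Set where
    field
      fun   : Carrier A → Carrier B
      isHom : IsHom A B fun

record Variety : Set₁ where
  field
    sig  : Signature
    Eqn  : Set
    lhs  : Eqn → Term sig ℕ
    rhs  : Eqn → Term sig ℕ

module _ (D : Variety) where
  open Variety D
  open Signature sig
  open Algebra
  open Hom

  InD : Algebra sig → Set
  InD A = ∀ e (ρ : ℕ → Carrier A) →
          _≈_ A (eval sig A ρ (lhs e)) (eval sig A ρ (rhs e))

  record DAlg : Set₁ where
    field
      alg : Algebra sig
      inD : InD alg

  -- D is commutative: for all A, B in D, [A,B] is a subalgebra of B^|A|
  IsCommutative : Set₁
  IsCommutative = ∀ (A B : Algebra sig) → InD A → InD B →
    ∀ o (hs : Fin (arity o) → Hom sig A B) →
    IsHom sig A B (λ a → ⟦_⟧ B o (λ i → fun (hs i) a))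

  record DMonoid : Set₁ where
    field
      alg      : Algebra sig
      inD      : InD alg
      _∙_      : Carrier alg → Carrier alg → Carrier alg
      ε        : Carrier alg
      assoc    : ∀ a b c → _≈_ alg ((a ∙ b) ∙ c) (a ∙ (b ∙ c))
      identityˡ : ∀ a → _≈_ alg (ε ∙ a) a
      identityʳ : ∀ a → _≈_ alg (a ∙ ε) a
      ∙-homˡ   : ∀ a → IsHom sig alg alg (λ b → a ∙ b)
      ∙-homʳ   : ∀ b → IsHom sig alg alg (λ a → a ∙ b)

  open DMonoid

  record IsMonMor (M N : DMonoid) (h : Carrier (alg M) → Carrier (alg N)) : Set where
    field
      isHom  : IsHom sig (alg M) (alg N) h
      ∙-pres : ∀ a b → _≈_ (alg N) (h (_∙_ M a b)) (_∙_ N (h a) (h b))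
      ε-pres : _≈_ (alg N) (h (ε M)) (ε N)

  record MonMor (M N : DMonoid) : Set where
    field
      fun      : Carrier (alg M) → Carrier (alg N)
      isMonMor : IsMonMor M N fun

  open MonMor renaming (fun to mfun)

  record IsFree (X : DAlg) (X* : DMonoid) (η : Hom sig (DAlg.alg X) (alg X*)) : Set₁ where
    field
      extend  : ∀ (M : DMonoid) (g : Hom sig (DAlg.alg X) (alg M)) →
                Σ (MonMor X* M) (λ g♯ → ∀ x →
                  _≈_ (alg M) (mfun g♯ (fun η x)) (fun g x))
      unique  : ∀ (M : DMonoid) (h k : MonMor X* M) →
                (∀ x → _≈_ (alg M) (mfun h (fun η x)) (mfun k (fun η x))) →
                ∀ u → _≈_ (alg M) (mfun h u) (mfun k u)

  module _ (X* : DMonoid) (Y : DAlg) (L : Hom sig (alg X*) (DAlg.alg Y)) where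
    private
      _≈Y_ = _≈_ (DAlg.alg Y)

    Surjective : {M : DMonoid} → MonMor X* M → Set
    Surjective {M} e = ∀ m → ∃ λ u → _≈_ (alg M) (mfun e u) m

    Recognizes : {M : DMonoid} → MonMor X* M → Set
    Recognizes {M} e = ∃ λ (f : Hom sig (alg M) (DAlg.alg Y)) →
                         ∀ u → fun f (mfun e u) ≈Y fun L u

    _≤_ : {M₁ M₂ : DMonoid} → MonMor X* M₁ → MonMor X* M₂ → Set
    _≤_ {M₁} {M₂} e₁ e₂ = ∃ λ (h : MonMor M₂ M₁) →
                            ∀ u → _≈_ (alg M₁) (mfun h (mfun e₂ u)) (mfun e₁ u)

    IsSyntactic : (M : DMonoid) → MonMor X* M → Set₁
    IsSyntactic M e = Surjective e × Recognizes e ×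
      (∀ (N : DMonoid) (e' : MonMor X* N) → Surjective e' → Recognizes e' → e ≤ e')

    _≡L_ : Rel (Carrier (alg X*)) 0ℓ
    u ≡L v = ∀ x y → fun L (_∙_ X* (_∙_ X* x u) y) ≈Y fun L (_∙_ X* (_∙_ X* x v) y)

  record IsCongruence (M : DMonoid) (R : Rel (Carrier (alg M)) 0ℓ) : Set where
    field
      isEquivalence : IsEquivalence R
      ≈⇒R           : ∀ {u v} → _≈_ (alg M) u v → R u v
      op-closed     : ∀ o {us vs : Fin (arity o) → Carrier (alg M)} →
                      (∀ i → R (us i) (vs i)) → R (⟦_⟧ (alg M) o us) (⟦_⟧ (alg M) o vs)
      ∙-closed      : ∀ {u u' v v'} → R u v → R u' v' → R (_∙_ M u u') (_∙_ M v v')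
      ε-closed      : R (ε M) (ε M)

  Quotient : (M : DMonoid) (R : Rel (Carrier (alg M)) 0ℓ) → IsCongruence M R → DMonoid
  Quotient M R c = record
    { alg = qalg
    ; inD = λ e ρ → IsCongruence.≈⇒R c (inD M e ρ)
    ; _∙_ = _∙_ M
    ; ε = ε M
    ; assoc = λ a b c' → IsCongruence.≈⇒R c (assoc M a b c')
    ; identityˡ = λ a → IsCongruence.≈⇒R c (identityˡ M a)
    ; identityʳ = λ a → IsCongruence.≈⇒R c (identityʳ M a)
    ; ∙-homˡ = λ a → record
        { cong = λ p → IsCongruence.∙-closed c (refl' {a}) p
        ; preserves = λ o as → IsCongruence.≈⇒R c (IsHom.preserves (∙-homˡ M a) o as) }
    ; ∙-homʳ = λ b → record
        { cong = λ p → IsCongruence.∙-closed c p (refl' {b})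
        ; preserves = λ o as → IsCongruence.≈⇒R c (IsHom.preserves (∙-homʳ M b) o as) }
    }
    where
    refl' : ∀ {a} → R a a
    refl' = IsEquivalence.refl (IsCongruence.isEquivalence c)
    qalg : Algebra sig
    qalg = record
      { Carrier = Carrier (alg M)
      ; _≈_ = R
      ; isEquivalence = IsCongruence.isEquivalence c
      ; ⟦_⟧ = ⟦_⟧ (alg M)
      ; ⟦⟧-cong = IsCongruence.op-closed c }

  quotMap : (M : DMonoid) (R : Rel (Carrier (alg M)) 0ℓ) (c : IsCongruence M R) →
            MonMor M (Quotient M R c)
  quotMap M R c = record
    { fun = id
    ; isMonMor = record
      { isHom = record
        { cong = IsCongruence.≈⇒R c
        ; preserves = λ o as → refl' }
      ; ∙-pres = λ a b → refl'
      ; ε-pres = refl' } }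
    where
    refl' : ∀ {a} → R a a
    refl' = IsEquivalence.refl (IsCongruence.isEquivalence c)

module Submission where

-- Write L[x,y](u) for
-- L((x ∙ u) ∙ y); since ∙ is a bimorphism, each "context" L[x,y] is a
-- homomorphism, and u ≡L v says precisely that u and v have the same image
-- under every context.  Hence ≡L is the intersection of the kernels of
-- homomorphisms, so it is an equivalence closed under the operations; by
-- reassociating the contexts it is closed under ∙ as well: a congruence.
-- Taking the empty context shows that L factors through M/≡L.
-- Minimality rests on two general facts:
--   * a morphism e recognising L has kernel contained in ≡L
--     (L[x,y](u) = f(e x ∙ e u ∙ e y) only depends on e u), and
--   * a surjective D-monoid morphism e : M → N whose kernel is contained in
--     a congruence R factors as M --e--> N --h--> M/R (h picks preimages).

open import Level using (0ℓ)
open import Data.Fin using (Fin)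
open import Data.Product using (Σ; ∃; _,_; proj₁; proj₂)
open import Relation.Binary using (Rel; IsEquivalence; Setoid)
import Relation.Binary.Reasoning.Setoid as SetoidReasoning

open import Defs

module Algebras {S : Signature} where
  open Signature S
  open Algebra

  setoid : Algebra S → Setoid 0ℓ 0ℓ
  setoid A = record { Carrier = Carrier A ; _≈_ = _≈_ A ; isEquivalence = isEquivalence A }

  isHom-∘ : ∀ {A B C} {g : Carrier B → Carrier C} {f : Carrier A → Carrier B} →
            IsHom S B C g → IsHom S A B f → IsHom S A C (λ a → g (f a))
  isHom-∘ {C = C} {g} {f} gh fh = record
    { cong      = λ p → IsHom.cong gh (IsHom.cong fh p)
    ; preserves = λ o as → IsEquivalence.trans (isEquivalence C)
        (IsHom.cong gh (IsHom.preserves fh o as)) (IsHom.preserves gh o (λ i → f (as i)))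
    }

  kernel-op-closed : ∀ {A B} {g : Carrier A → Carrier B} → IsHom S A B g →
    ∀ o {us vs : Fin (arity o) → Carrier A} → (∀ i → _≈_ B (g (us i)) (g (vs i))) →
    _≈_ B (g (⟦_⟧ A o us)) (g (⟦_⟧ A o vs))
  kernel-op-closed {A} {B} {g} gh o {us} {vs} p = begin
    g (⟦_⟧ A o us)             ≈⟨ IsHom.preserves gh o us ⟩
    ⟦_⟧ B o (λ i → g (us i))   ≈⟨ ⟦⟧-cong B o p ⟩
    ⟦_⟧ B o (λ i → g (vs i))   ≈⟨ IsHom.preserves gh o vs ⟨
    g (⟦_⟧ A o vs)             ∎
    where open SetoidReasoning (setoid B)

module Theory (D : Variety) where
  open Variety D
  open Signature sig
  open Algebra
  open DMonoid
  open Algebras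

  ∙-cong : (M : DMonoid D) → ∀ {a b c d} → _≈_ (alg M) a b → _≈_ (alg M) c d →
           _≈_ (alg M) (_∙_ M a c) (_∙_ M b d)
  ∙-cong M {b = b} {c = c} p q = IsEquivalence.trans (isEquivalence (alg M))
    (IsHom.cong (∙-homʳ M c) p) (IsHom.cong (∙-homˡ M b) q)

  -- A surjective D-monoid morphism e : M → N whose kernel lies inside a
  -- congruence R factors through the quotient map: choosing preimages gives a
  -- morphism h : N → M/R with h ∘ e = id on M/R.
  factor-through-quotient :
    (M N : DMonoid D) (R : Rel (Carrier (alg M)) 0ℓ) (c : IsCongruence D M R)
    (e : MonMor D M N) →
    (∀ n → ∃ λ u → _≈_ (alg N) (MonMor.fun e u) n) →
    (∀ {u v} → _≈_ (alg N) (MonMor.fun e u) (MonMor.fun e v) → R u v) →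
    Σ (MonMor D N (Quotient D M R c)) λ h → ∀ u → R (MonMor.fun h (MonMor.fun e u)) u
  factor-through-quotient M N R c e surj ker⊆R = hom , λ u → ker⊆R (section (ef u))
    where
    open SetoidReasoning (setoid (alg N))
    ef = MonMor.fun e
    open IsMonMor (MonMor.isMonMor e)

    preimage : Carrier (alg N) → Carrier (alg M)
    preimage n = proj₁ (surj n)

    section : ∀ n → _≈_ (alg N) (ef (preimage n)) n
    section n = proj₂ (surj n)

    hom : MonMor D N (Quotient D M R c)
    hom = record
      { fun      = preimage
      ; isMonMor = record
        { isHom  = record
          { cong      = λ {n} {n'} p → ker⊆R (begin
              ef (preimage n)  ≈⟨ section n ⟩
              n                ≈⟨ p ⟩
              n'               ≈⟨ section n' ⟨
              ef (preimage n') ∎)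
          ; preserves = λ o ns → ker⊆R (begin
              ef (preimage (⟦_⟧ (alg N) o ns))            ≈⟨ section _ ⟩
              ⟦_⟧ (alg N) o ns                             ≈⟨ ⟦⟧-cong (alg N) o (λ i → section (ns i)) ⟨
              ⟦_⟧ (alg N) o (λ i → ef (preimage (ns i)))   ≈⟨ IsHom.preserves isHom o _ ⟨
              ef (⟦_⟧ (alg M) o (λ i → preimage (ns i)))   ∎)
          }
        ; ∙-pres = λ n n' → ker⊆R (begin
            ef (preimage (_∙_ N n n'))                    ≈⟨ section _ ⟩
            _∙_ N n n'                                     ≈⟨ ∙-cong N (section n) (section n') ⟨
            _∙_ N (ef (preimage n)) (ef (preimage n'))     ≈⟨ ∙-pres _ _ ⟨
            ef (_∙_ M (preimage n) (preimage n'))          ∎)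
        ; ε-pres = ker⊆R (begin
            ef (preimage (ε N)) ≈⟨ section _ ⟩
            ε N                 ≈⟨ ε-pres ⟨
            ef (ε M)            ∎)
        }
      }

  module Syntactic (M : DMonoid D) (Y : DAlg D) (L : Hom sig (alg M) (DAlg.alg Y)) where
    private
      A = DAlg.alg Y
      _≈M_ = _≈_ (alg M)
      _≈Y_ = _≈_ A
      _·_ = _∙_ M
      Lf = Hom.fun L
      Lcong = IsHom.cong (Hom.isHom L)
      module ≈M = IsEquivalence (isEquivalence (alg M))
      module ≈Y = IsEquivalence (isEquivalence A)
      _≡ₗ_ = _≡L_ D M Y L

    context-isHom : ∀ x y → IsHom sig (alg M) A (λ u → Lf ((x · u) · y))
    context-isHom x y = isHom-∘ (Hom.isHom L) (isHom-∘ (∙-homʳ M y) (∙-homˡ M x))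

    ≡L-isEquivalence : IsEquivalence _≡ₗ_
    ≡L-isEquivalence = record
      { refl  = λ x y → ≈Y.refl
      ; sym   = λ p x y → ≈Y.sym (p x y)
      ; trans = λ p q x y → ≈Y.trans (p x y) (q x y)
      }

    ≈⇒≡L : ∀ {u v} → u ≈M v → u ≡ₗ v
    ≈⇒≡L p x y = IsHom.cong (context-isHom x y) p

    ≡L-op-closed : ∀ o {us vs : Fin (arity o) → Carrier (alg M)} →
      (∀ i → us i ≡ₗ vs i) → ⟦_⟧ (alg M) o us ≡ₗ ⟦_⟧ (alg M) o vs
    ≡L-op-closed o p x y = kernel-op-closed (context-isHom x y) o (λ i → p i x y)

    -- Right multiplication: the context (x, w ∙ y) absorbs w.
    ≡L-∙ʳ : ∀ {u v} w → u ≡ₗ v → (u · w) ≡ₗ (v · w)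
    ≡L-∙ʳ {u} {v} w p x y = begin
      Lf ((x · (u · w)) · y)   ≈⟨ Lcong (shift u) ⟩
      Lf ((x · u) · (w · y))   ≈⟨ p x (w · y) ⟩
      Lf ((x · v) · (w · y))   ≈⟨ Lcong (shift v) ⟨
      Lf ((x · (v · w)) · y)   ∎
      where
      open SetoidReasoning (setoid A)
      shift : ∀ t → ((x · (t · w)) · y) ≈M ((x · t) · (w · y))
      shift t = ≈M.trans (∙-cong M (≈M.sym (assoc M x t w)) ≈M.refl) (assoc M (x · t) w y)

    -- Left multiplication: the context (x ∙ w, y) absorbs w.
    ≡L-∙ˡ : ∀ {u v} w → u ≡ₗ v → (w · u) ≡ₗ (w · v)
    ≡L-∙ˡ {u} {v} w p x y = begin
      Lf ((x · (w · u)) · y)   ≈⟨ Lcong (shift u) ⟩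
      Lf (((x · w) · u) · y)   ≈⟨ p (x · w) y ⟩
      Lf (((x · w) · v) · y)   ≈⟨ Lcong (shift v) ⟨
      Lf ((x · (w · v)) · y)   ∎
      where
      open SetoidReasoning (setoid A)
      shift : ∀ t → ((x · (w · t)) · y) ≈M (((x · w) · t) · y)
      shift t = ∙-cong M (≈M.sym (assoc M x w t)) ≈M.refl

    ≡L-isCongruence : IsCongruence D M _≡ₗ_
    ≡L-isCongruence = record
      { isEquivalence = ≡L-isEquivalence
      ; ≈⇒R           = ≈⇒≡L
      ; op-closed     = ≡L-op-closed
      ; ∙-closed      = λ {_} {u'} {v} p q →
          IsEquivalence.trans ≡L-isEquivalence (≡L-∙ʳ u' p) (≡L-∙ˡ v q)
      ; ε-closed      = IsEquivalence.refl ≡L-isEquivalence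
      }

    ≡L⇒L≈ : ∀ {u v} → u ≡ₗ v → Lf u ≈Y Lf v
    ≡L⇒L≈ {u} {v} p = begin
      Lf u                      ≈⟨ Lcong (unit u) ⟨
      Lf ((ε M · u) · ε M)      ≈⟨ p (ε M) (ε M) ⟩
      Lf ((ε M · v) · ε M)      ≈⟨ Lcong (unit v) ⟩
      Lf v                      ∎
      where
      open SetoidReasoning (setoid A)
      unit : ∀ t → ((ε M · t) · ε M) ≈M t
      unit t = ≈M.trans (identityʳ M _) (identityˡ M t)

    Syn : DMonoid D
    Syn = Quotient D M _≡ₗ_ ≡L-isCongruence

    syn : MonMor D M Syn
    syn = quotMap D M _≡ₗ_ ≡L-isCongruence

    syn-recognizes : Recognizes D M Y L syn
    syn-recognizes = L′ , λ u → ≈Y.refl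
      where
      L′ : Hom sig (alg Syn) A
      L′ = record { fun = Lf
                  ; isHom = record { cong = ≡L⇒L≈ ; preserves = IsHom.preserves (Hom.isHom L) } }

    recognizer-kernel⊆≡L : ∀ {N} (e : MonMor D M N) → Recognizes D M Y L e →
      ∀ {u v} → _≈_ (alg N) (MonMor.fun e u) (MonMor.fun e v) → u ≡ₗ v
    recognizer-kernel⊆≡L {N} e (f , f∘e≈L) {u} {v} p x y = begin
      Lf ((x · u) · y)              ≈⟨ f∘e≈L _ ⟨
      ff (ef ((x · u) · y))         ≈⟨ IsHom.cong (Hom.isHom f) (expand u) ⟩
      ff ((ef x ∙N ef u) ∙N ef y)   ≈⟨ IsHom.cong (Hom.isHom f) (∙-cong N (∙-cong N ≈N.refl p) ≈N.refl) ⟩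
      ff ((ef x ∙N ef v) ∙N ef y)   ≈⟨ IsHom.cong (Hom.isHom f) (expand v) ⟨
      ff (ef ((x · v) · y))         ≈⟨ f∘e≈L _ ⟩
      Lf ((x · v) · y)              ∎
      where
      open SetoidReasoning (setoid A)
      module ≈N = IsEquivalence (isEquivalence (alg N))
      _∙N_ = _∙_ N
      ef = MonMor.fun e
      ff = Hom.fun f
      e-∙ = IsMonMor.∙-pres (MonMor.isMonMor e)
      expand : ∀ t → _≈_ (alg N) (ef ((x · t) · y)) ((ef x ∙N ef t) ∙N ef y)
      expand t = ≈N.trans (e-∙ _ y) (∙-cong N (e-∙ x t) ≈N.refl)

    syn-isSyntactic : IsSyntactic D M Y L Syn syn
    syn-isSyntactic =
        (λ u → u , IsEquivalence.refl ≡L-isEquivalence)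
      , syn-recognizes
      , λ N e surj rec → factor-through-quotient M N _≡ₗ_ ≡L-isCongruence e surj
                                                 (recognizer-kernel⊆≡L e rec)

theorem3p13 : (D : Variety) → IsCommutative D →
    (X : DAlg D) (X* : DMonoid D) (η : Hom (Variety.sig D) (DAlg.alg X) (DMonoid.alg X*)) →
    IsFree D X X* η →
    (Y : DAlg D) (L : Hom (Variety.sig D) (DMonoid.alg X*) (DAlg.alg Y)) →
    Σ (IsCongruence D X* (_≡L_ D X* Y L)) λ c →
      IsSyntactic D X* Y L (Quotient D X* (_≡L_ D X* Y L) c) (quotMap D X* (_≡L_ D X* Y L) c)
theorem3p13 D _ _ X* _ _ Y L = ≡L-isCongruence , syn-isSyntactic
  where open Theory.Syntactic D X* Y L
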